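{- Let $G$ and $H$ be connected graphs of order at least $3$. If $G \times H$ is well-dominated, then every minimum dominating set of $G$ and every minimum dominating set of $H$ is an independent set.
   Context: All graphs are finite, simple and undirected. A dominating set of $X$ is a set $D$ of vertices such that every vertex is in $D$ or adjacent to a vertex of $D$; a minimum dominating set has the least possible size $\gamma(X)$. $\Gamma(X)$ is the maximum size of a minimal (inclusion-wise) dominating set; $X$ is well-dominated if $\gamma(X)=\Gamma(X)$. The direct product $G\times H$ has vertex set $V(G)\times V(H)$, with $(g_1,h_1)\sim(g_2,h_2)$ iff $g_1g_2\in E(G)$ and $h_1h_2\in E(H)$. -}

module Defs where

open import Data.Nat using (ℕ; _*_; _≤_)
open import Data.Bool using (Bool; true; false; T; _∧_)
open import Data.Fin using (Fin; remQuot)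
open import Data.Fin.Subset using (Subset; _∈_; _⊂_; ∣_∣)
open import Data.Product using (Σ; ∃; _×_; _,_; proj₁; proj₂)
open import Data.Sum using (_⊎_)
open import Relation.Nullary using (¬_)
open import Relation.Binary.PropositionalEquality using (_≡_; refl)
open import Relation.Binary.Construct.Closure.ReflexiveTransitive using (Star)

record Graph : Set where
  field
    order : ℕ
    adj   : Fin order → Fin order → Bool
    sym   : ∀ u v → adj u v ≡ adj v u
    irr   : ∀ v → adj v v ≡ false

open Graph public

E : (G : Graph) → Fin (order G) → Fin (order G) → Set
E G u v = T (adj G u v)

Connected : Graph → Set
Connected G = ∀ u v → Star (E G) u v

Dominating : (G : Graph) → Subset (order G) → Set
Dominating G D = ∀ v → v ∈ D ⊎ Σ (Fin (order G)) (λ u → u ∈ D × E G u v)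

MinimumDominating : (G : Graph) → Subset (order G) → Set
MinimumDominating G D =
  Dominating G D × (∀ D′ → Dominating G D′ → ∣ D ∣ ≤ ∣ D′ ∣)

MinimalDominating : (G : Graph) → Subset (order G) → Set
MinimalDominating G D =
  Dominating G D × (∀ D′ → D′ ⊂ D → ¬ Dominating G D′)

-- well-dominated: γ(G) = Γ(G), i.e. every minimal dominating set has
-- size at most γ(G) (the size of a minimum dominating set); since
-- γ ≤ Γ always, this is exactly Γ ≤ γ.
WellDominated : Graph → Set
WellDominated G =
  ∀ D → MinimalDominating G D → ∀ D′ → MinimumDominating G D′ → ∣ D ∣ ≤ ∣ D′ ∣

Independent : (G : Graph) → Subset (order G) → Set
Independent G D = ∀ u v → u ∈ D → v ∈ D → ¬ E G u v

-- direct (tensor) product; vertex set Fin (n * m) ≅ Fin n × Fin m via remQuot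
split : (G H : Graph) → Fin (order G * order H) → Fin (order G) × Fin (order H)
split G H x = remQuot {order G} (order H) x

productAdj : (G H : Graph) → Fin (order G * order H) → Fin (order G * order H) → Bool
productAdj G H x y =
  adj G (proj₁ (split G H x)) (proj₁ (split G H y))
  ∧ adj H (proj₂ (split G H x)) (proj₂ (split G H y))

private
  ∧-cong : ∀ a b c d → a ≡ c → b ≡ d → (a ∧ b) ≡ (c ∧ d)
  ∧-cong a b .a .b refl refl = refl

  ∧-false : ∀ a b → b ≡ false → (a ∧ b) ≡ false
  ∧-false false .false refl = refl
  ∧-false true  .false refl = refl

productSym : (G H : Graph) → ∀ x y → productAdj G H x y ≡ productAdj G H y x
productSym G H x y = ∧-cong _ _ _ _
  (sym G (proj₁ (split G H x)) (proj₁ (split G H y)))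
  (sym H (proj₂ (split G H x)) (proj₂ (split G H y)))

productIrr : (G H : Graph) → ∀ x → productAdj G H x x ≡ false
productIrr G H x = ∧-false _ _ (irr H (proj₂ (split G H x)))

_×ᴳ_ : Graph → Graph → Graph
G ×ᴳ H = record
  { order = order G * order H
  ; adj   = productAdj G H
  ; sym   = productSym G H
  ; irr   = productIrr G H
  }

-- Let D be a minimum dominating set of G containing an edge uv. Because H is
-- connected with at least three vertices, it has a vertex h₀ such that every
-- vertex of H has a neighbour other than h₀. Then (D × V(H)) ∖ {(u, h₀)} still
-- dominates G × H, since (v, h′) dominates (u, h₀) for a neighbour h′ ≠ h₀ of
-- h₀; so γ(G × H) < |D| |H| ≤ |I| |H| for a maximal independent set I of G.
-- But I × V(H) is a minimal dominating set of G × H, hence Γ(G × H) > γ(G × H).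
module Submission where

open import Data.Bool using (Bool; T; _∧_)
open import Data.Bool.Properties using (T-∧; ∧-comm)
open import Data.Empty using (⊥-elim)
open import Data.Fin using (Fin; zero; suc; _↑ˡ_; _↑ʳ_; fromℕ<; combine; quotient; remainder; remQuot)
open import Data.Fin.Properties using (any?; all?; ¬∀⟶∃¬; remQuot-combine; splitAt-↑ʳ; _≟_)
open import Data.Fin.Subset using (Subset; inside; outside; _∈_; _⊂_; ∣_∣; ⊥; _∪_; ⁅_⁆; _-_)
open import Data.Fin.Subset.Properties
  using (_∈?_; anySubset?; ∉⊥; x∈⁅x⁆; x∈⁅y⁆⇒x≡y; p⊆p∪q; x∈p∪q⁻; x∈p∪q⁺; p⊂q⇒∣p∣<∣q∣; ∣p∣≤n; ∣⊤∣≡n; ∣⊥∣≡0;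
         x∈p∧x≢y⇒x∈p-y; x∈p⇒∣p-x∣<∣p∣)
open import Data.Nat using (ℕ; zero; suc; _+_; _*_; _∸_; _≤_; _<_; s≤s; z≤n; _<?_)
open import Data.Nat.Induction using (<-wellFounded)
open import Data.Nat.Properties
  using (≤-trans; <-irrefl; ≮⇒≥; <⇒≱; ∸-monoʳ-<; *-monoˡ-≤; *-comm; module ≤-Reasoning)
open import Data.Product using (∃; ∃-syntax; _×_; _,_; proj₁; proj₂; map₁; map₂)
open import Data.Sum using (_⊎_; inj₁; inj₂; [_,_])
open import Data.Vec using ([]; _∷_; tabulate; lookup; replicate)
open import Data.Vec.Properties using (tabulate-cong; tabulate∘lookup; lookup∘tabulate; []=⇒lookup; lookup⇒[]=)
open import Function using (_∘_; id; Equivalence)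
open import Induction.WellFounded using (Acc; acc)
open import Relation.Binary.Construct.Closure.ReflexiveTransitive using (Star; ε; _◅_; fold)
open import Relation.Binary.PropositionalEquality
  using (_≡_; _≢_; refl; cong; cong₂; subst; trans; module ≡-Reasoning) renaming (sym to ≡-sym)
open import Relation.Nullary using (¬_; Dec; yes; no)
open import Relation.Nullary.Decidable using (_×-dec_; _⊎-dec_; _→-dec_; ¬?; T?; decidable-stable)
open import Relation.Unary using (Decidable)

open import Defs

minimiser : ∀ {n} {P : Subset n → Set} → Decidable P → (f : Subset n → ℕ) →
            ∃ P → ∃[ S ] P S × (∀ S′ → P S′ → f S ≤ f S′)
minimiser {P = P} P? f (S , pS) = descend S pS (<-wellFounded (f S))
  where
  descend : ∀ S → P S → Acc _<_ (f S) → ∃[ S* ] P S* × (∀ S′ → P S′ → f S* ≤ f S′)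
  descend S pS (acc smaller) with anySubset? (λ S′ → P? S′ ×-dec (f S′ <? f S))
  ... | yes (S′ , pS′ , f[S′]<f[S]) = descend S′ pS′ (smaller f[S′]<f[S])
  ... | no none = S , pS , λ S′ pS′ → ≮⇒≥ (λ f[S′]<f[S] → none (S′ , pS′ , f[S′]<f[S]))

module _ (G : Graph) where

  E-sym : ∀ {u v} → E G u v → E G v u
  E-sym {u} {v} = subst T (sym G u v)

  E-irrefl : ∀ {v} → ¬ E G v v
  E-irrefl {v} = subst T (irr G v)

  dominating? : Decidable (Dominating G)
  dominating? D = all? (λ v → (v ∈? D) ⊎-dec any? (λ u → (u ∈? D) ×-dec T? (adj G u v)))

  independent? : Decidable (Independent G)
  independent? I = all? (λ u → all? (λ v → (u ∈? I) →-dec ((v ∈? I) →-dec ¬? (T? (adj G u v)))))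

  minimumDominating-exists : ∀ {S} → Dominating G S → ∃ (MinimumDominating G)
  minimumDominating-exists dom = minimiser (dominating?) ∣_∣ (_ , dom)

  MaximalIndependent : Subset (order G) → Set
  MaximalIndependent I = Independent G I × (∀ J → I ⊂ J → ¬ Independent G J)

  maximalIndependent-exists : ∃ MaximalIndependent
  maximalIndependent-exists
    with minimiser (independent?) (λ S → order G ∸ ∣ S ∣) (⊥ , λ u _ u∈⊥ → ⊥-elim (∉⊥ u∈⊥))
  ... | I , ind , largest = I , ind , λ J I⊂J indJ →
    <⇒≱ (∸-monoʳ-< (p⊂q⇒∣p∣<∣q∣ I⊂J) (∣p∣≤n J)) (largest J indJ)

  independent⇒minimal : ∀ {I} → Independent G I → ∀ D → D ⊂ I → ¬ Dominating G D
  independent⇒minimal ind D (D⊆I , y , y∈I , y∉D) dom with dom y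
  ... | inj₁ y∈D            = y∉D y∈D
  ... | inj₂ (z , z∈D , e)  = ind z y (D⊆I z∈D) y∈I e

  independent-∪⁅⁆ : ∀ {I v} → Independent G I → (∀ u → u ∈ I → ¬ E G u v) →
                    Independent G (I ∪ ⁅ v ⁆)
  independent-∪⁅⁆ {I} {v} ind v-free a b a∈ b∈ with x∈p∪q⁻ I ⁅ v ⁆ a∈ | x∈p∪q⁻ I ⁅ v ⁆ b∈
  ... | inj₁ a∈I | inj₁ b∈I = ind a b a∈I b∈I
  ... | inj₁ a∈I | inj₂ b∈v rewrite x∈⁅y⁆⇒x≡y v b∈v = v-free a a∈I
  ... | inj₂ a∈v | inj₁ b∈I rewrite x∈⁅y⁆⇒x≡y v a∈v = v-free b b∈I ∘ E-sym
  ... | inj₂ a∈v | inj₂ b∈v rewrite x∈⁅y⁆⇒x≡y v a∈v | x∈⁅y⁆⇒x≡y v b∈v = E-irrefl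

  maximalIndependent⇒dominating : ∀ {I} → MaximalIndependent I → Dominating G I
  maximalIndependent⇒dominating {I} (ind , maximal) v with v ∈? I
  ... | yes v∈I = inj₁ v∈I
  ... | no v∉I with any? (λ u → (u ∈? I) ×-dec T? (adj G u v))
  ...   | yes dominated = inj₂ dominated
  ...   | no undominated = ⊥-elim (maximal (I ∪ ⁅ v ⁆) I⊂I∪v
          (independent-∪⁅⁆ ind (λ u u∈I e → undominated (u , u∈I , e))))
    where
    I⊂I∪v : I ⊂ I ∪ ⁅ v ⁆
    I⊂I∪v = p⊆p∪q ⁅ v ⁆ , v , x∈p∪q⁺ (inj₂ (x∈⁅x⁆ v)) , v∉I

avoidTwo : ∀ {n} → 3 ≤ n → (p q : Fin n) → ∃[ c ] c ≢ p × c ≢ q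
avoidTwo (s≤s (s≤s (s≤s _))) (suc _)       (suc _)       = zero , (λ ()) , (λ ())
avoidTwo (s≤s (s≤s (s≤s _))) zero          zero          = suc zero , (λ ()) , (λ ())
avoidTwo (s≤s (s≤s (s≤s _))) zero          (suc zero)    = suc (suc zero) , (λ ()) , (λ ())
avoidTwo (s≤s (s≤s (s≤s _))) zero          (suc (suc _)) = suc zero , (λ ()) , (λ ())
avoidTwo (s≤s (s≤s (s≤s _))) (suc zero)    zero          = suc (suc zero) , (λ ()) , (λ ())
avoidTwo (s≤s (s≤s (s≤s _))) (suc (suc _)) zero          = suc zero , (λ ()) , (λ ())

Star-closed : ∀ {A : Set} {R : A → A → Set} {P : A → Set} →
              (∀ {x y} → R x y → P x → P y) → ∀ {x y} → Star R x y → P x → P y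
Star-closed {P = P} step = fold (λ x y → P x → P y) (λ r k → k ∘ step r) id

Star-first-step : ∀ {A : Set} {R : A → A → Set} {x y} → Star R x y → y ≢ x → ∃ (R x)
Star-first-step ε       y≢x = ⊥-elim (y≢x refl)
Star-first-step (r ◅ _) _   = _ , r

module _ (B : Graph) where

  Avoidable : Fin (order B) → Set
  Avoidable h₀ = ∀ h → ∃[ h′ ] h′ ≢ h₀ × E B h′ h

  OnlyNeighbour : Fin (order B) → Fin (order B) → Set
  OnlyNeighbour h₀ h = ∀ h′ → E B h′ h → h′ ≡ h₀

  other-neighbour? : ∀ h₀ h → Dec (∃[ h′ ] h′ ≢ h₀ × E B h′ h)
  other-neighbour? h₀ h = any? (λ h′ → ¬? (h′ ≟ h₀) ×-dec T? (adj B h′ h))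

  avoidable? : Decidable Avoidable
  avoidable? h₀ = all? (other-neighbour? h₀)

  ¬avoidable⇒onlyNeighbour : ∀ {h₀} → ¬ Avoidable h₀ → ∃ (OnlyNeighbour h₀)
  ¬avoidable⇒onlyNeighbour {h₀} ¬avoidable with ¬∀⟶∃¬ _ _ (other-neighbour? h₀) ¬avoidable
  ... | h , no-other = h , λ h′ e → decidable-stable (h′ ≟ h₀) (λ h′≢h₀ → no-other (h′ , h′≢h₀ , e))

  module _ (connected : Connected B) (3≤n : 3 ≤ order B) where

    someVertex : Fin (order B)
    someVertex = fromℕ< (≤-trans (s≤s z≤n) 3≤n)

    has-neighbour : ∀ x → ∃ (E B x)
    has-neighbour x with avoidTwo 3≤n x x
    ... | y , y≢x , _ = Star-first-step (connected x y) y≢x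

    -- Some w has N(w) ⊆ {a}, so N(w) = {a}; the vertex whose only possible
    -- neighbour is w must then be a, hence {a, w} is a whole component.
    no-avoidable⇒pair-component : (∀ h₀ → ¬ Avoidable h₀) → ∀ a →
                                  ∃[ w ] ∀ {x} → Star (E B) a x → x ≡ a ⊎ x ≡ w
    no-avoidable⇒pair-component none a = w , λ path → Star-closed step path (inj₁ refl)
      where
      w : Fin (order B)
      w = proj₁ (¬avoidable⇒onlyNeighbour (none a))
      Nw⊆a : OnlyNeighbour a w
      Nw⊆a = proj₂ (¬avoidable⇒onlyNeighbour (none a))
      w′ : Fin (order B)
      w′ = proj₁ (¬avoidable⇒onlyNeighbour (none w))
      Nw′⊆w : OnlyNeighbour w w′
      Nw′⊆w = proj₂ (¬avoidable⇒onlyNeighbour (none w))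
      w′≡a : w′ ≡ a
      w′≡a with has-neighbour w′
      ... | y , e = Nw⊆a w′ (subst (E B w′) (Nw′⊆w y (E-sym B e)) e)
      Na⊆w : OnlyNeighbour w a
      Na⊆w h′ e = Nw′⊆w h′ (subst (E B h′) (≡-sym w′≡a) e)
      step : ∀ {x y} → E B x y → x ≡ a ⊎ x ≡ w → y ≡ a ⊎ y ≡ w
      step e (inj₁ refl) = inj₂ (Na⊆w _ (E-sym B e))
      step e (inj₂ refl) = inj₁ (Nw⊆a _ (E-sym B e))

    ¬pair-component : ∀ {a} → ¬ (∃[ w ] ∀ {x} → Star (E B) a x → x ≡ a ⊎ x ≡ w)
    ¬pair-component {a} (w , component) with avoidTwo 3≤n a w
    ... | c , c≢a , c≢w = [ c≢a , c≢w ] (component (connected a c))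

    avoidable-exists : ∃ Avoidable
    avoidable-exists = decidable-stable (any? avoidable?) λ none →
      ¬pair-component (no-avoidable⇒pair-component (λ h₀ avoidable → none (h₀ , avoidable)) someVertex)

preimage : ∀ {m n} → (Fin m → Fin n) → Subset n → Subset m
preimage f p = tabulate (lookup p ∘ f)

module _ {m n} {f : Fin m → Fin n} {p : Subset n} {x : Fin m} where

  ∈-preimage⁺ : f x ∈ p → x ∈ preimage f p
  ∈-preimage⁺ fx∈p = lookup⇒[]= x (preimage f p) (trans (lookup∘tabulate (lookup p ∘ f) x) ([]=⇒lookup fx∈p))

  ∈-preimage⁻ : x ∈ preimage f p → f x ∈ p
  ∈-preimage⁻ x∈ = lookup⇒[]= (f x) p (trans (≡-sym (lookup∘tabulate (lookup p ∘ f) x)) ([]=⇒lookup x∈))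

∣tabulate∣-↑ : ∀ m k (f : Fin (m + k) → Bool) →
               ∣ tabulate f ∣ ≡ ∣ tabulate (f ∘ (_↑ˡ k)) ∣ + ∣ tabulate (f ∘ (m ↑ʳ_)) ∣
∣tabulate∣-↑ zero    k f = refl
∣tabulate∣-↑ (suc m) k f with f zero
... | inside  = cong suc (∣tabulate∣-↑ m k (f ∘ suc))
... | outside = ∣tabulate∣-↑ m k (f ∘ suc)

tabulate-const : ∀ m (c : Bool) → tabulate {n = m} (λ _ → c) ≡ replicate m c
tabulate-const zero    c = refl
tabulate-const (suc m) c = cong (c ∷_) (tabulate-const m c)

remQuot-↑ˡ : ∀ n m (j : Fin m) → remQuot {suc n} m (j ↑ˡ n * m) ≡ (zero , j)
remQuot-↑ˡ n m j = remQuot-combine zero j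

remQuot-↑ʳ : ∀ n m (x : Fin (n * m)) → remQuot {suc n} m (m ↑ʳ x) ≡ map₁ suc (remQuot {n} m x)
remQuot-↑ʳ n m x rewrite splitAt-↑ʳ m (n * m) x = refl

∣preimage-quotient∣ : ∀ n m (a : Subset n) → ∣ preimage (quotient {n} m) a ∣ ≡ ∣ a ∣ * m
∣preimage-quotient∣ zero    m []      = refl
∣preimage-quotient∣ (suc n) m (c ∷ a) = begin
  ∣ preimage (quotient m) (c ∷ a) ∣
    ≡⟨ ∣tabulate∣-↑ m (n * m) (lookup (c ∷ a) ∘ quotient m) ⟩
  ∣ tabulate (λ j → lookup (c ∷ a) (quotient m (j ↑ˡ n * m))) ∣
    + ∣ tabulate (λ x → lookup (c ∷ a) (quotient m (m ↑ʳ x))) ∣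
    ≡⟨ cong₂ (λ p q → ∣ p ∣ + ∣ q ∣) (trans (tabulate-cong first-block) (tabulate-const m c))
                                     (tabulate-cong other-blocks) ⟩
  ∣ replicate m c ∣ + ∣ preimage (quotient m) a ∣
    ≡⟨ cong (∣ replicate m c ∣ +_) (∣preimage-quotient∣ n m a) ⟩
  ∣ replicate m c ∣ + ∣ a ∣ * m
    ≡⟨ ∣replicate∣ c ⟩
  ∣ c ∷ a ∣ * m ∎
  where
  open ≡-Reasoning
  first-block : ∀ j → lookup (c ∷ a) (quotient m (j ↑ˡ n * m)) ≡ c
  first-block j = cong (lookup (c ∷ a) ∘ proj₁) (remQuot-↑ˡ n m j)
  other-blocks : ∀ x → lookup (c ∷ a) (quotient m (m ↑ʳ x)) ≡ lookup a (quotient m x)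
  other-blocks x = cong (lookup (c ∷ a) ∘ proj₁) (remQuot-↑ʳ n m x)
  ∣replicate∣ : ∀ c → ∣ replicate m c ∣ + ∣ a ∣ * m ≡ ∣ c ∷ a ∣ * m
  ∣replicate∣ inside  = cong (_+ ∣ a ∣ * m) (∣⊤∣≡n m)
  ∣replicate∣ outside = cong (_+ ∣ a ∣ * m) (∣⊥∣≡0 m)

∣preimage-remainder∣ : ∀ n m (b : Subset m) → ∣ preimage (remainder {n} m) b ∣ ≡ n * ∣ b ∣
∣preimage-remainder∣ zero    m b = refl
∣preimage-remainder∣ (suc n) m b = begin
  ∣ preimage (remainder {suc n} m) b ∣
    ≡⟨ ∣tabulate∣-↑ m (n * m) (lookup b ∘ remainder {suc n} m) ⟩
  ∣ tabulate (λ j → lookup b (remainder {suc n} m (j ↑ˡ n * m))) ∣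
    + ∣ tabulate (λ x → lookup b (remainder {suc n} m (m ↑ʳ x))) ∣
    ≡⟨ cong₂ (λ p q → ∣ p ∣ + ∣ q ∣) (trans (tabulate-cong first-block) (tabulate∘lookup b))
                                     (tabulate-cong other-blocks) ⟩
  ∣ b ∣ + ∣ preimage (remainder {n} m) b ∣
    ≡⟨ cong (∣ b ∣ +_) (∣preimage-remainder∣ n m b) ⟩
  ∣ b ∣ + n * ∣ b ∣ ∎
  where
  open ≡-Reasoning
  first-block : ∀ j → lookup b (remainder {suc n} m (j ↑ˡ n * m)) ≡ lookup b j
  first-block j = cong (lookup b ∘ proj₂) (remQuot-↑ˡ n m j)
  other-blocks : ∀ x → lookup b (remainder {suc n} m (m ↑ʳ x)) ≡ lookup b (remainder {n} m x)
  other-blocks x = cong (lookup b ∘ proj₂) (remQuot-↑ʳ n m x)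

-- X ≅ A × B with the factor A singled out; G ×ᴳ H is one in either order.
record DirectProduct (X A B : Graph) : Set where
  field
    πA      : Fin (order X) → Fin (order A)
    πB      : Fin (order X) → Fin (order B)
    pair    : Fin (order A) → Fin (order B) → Fin (order X)
    πA-pair : ∀ a b → πA (pair a b) ≡ a
    πB-pair : ∀ a b → πB (pair a b) ≡ b
    adj-π   : ∀ x y → adj X x y ≡ (adj A (πA x) (πA y) ∧ adj B (πB x) (πB y))
    ∣preimage-πA∣ : ∀ a → ∣ preimage πA a ∣ ≡ ∣ a ∣ * order B

×ᴳ-first : ∀ G H → DirectProduct (G ×ᴳ H) G H
×ᴳ-first G H = record
  { πA            = quotient {order G} (order H)
  ; πB            = remainder {order G} (order H)
  ; pair          = combine
  ; πA-pair       = λ a b → cong proj₁ (remQuot-combine a b)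
  ; πB-pair       = λ a b → cong proj₂ (remQuot-combine a b)
  ; adj-π         = λ _ _ → refl
  ; ∣preimage-πA∣ = ∣preimage-quotient∣ (order G) (order H)
  }

×ᴳ-second : ∀ G H → DirectProduct (G ×ᴳ H) H G
×ᴳ-second G H = record
  { πA            = remainder {order G} (order H)
  ; πB            = quotient {order G} (order H)
  ; pair          = λ h g → combine g h
  ; πA-pair       = λ h g → cong proj₂ (remQuot-combine g h)
  ; πB-pair       = λ h g → cong proj₁ (remQuot-combine g h)
  ; adj-π         = λ x y → ∧-comm (adj G _ _) (adj H _ _)
  ; ∣preimage-πA∣ = λ b → trans (∣preimage-remainder∣ (order G) (order H) b) (*-comm (order G) ∣ b ∣)
  }

module _ {X A B : Graph} (P : DirectProduct X A B) where
  open DirectProduct P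

  E-πA : ∀ {x y} → E X x y → E A (πA x) (πA y)
  E-πA {x} {y} e = proj₁ (Equivalence.to T-∧ (subst T (adj-π x y) e))

  E-pair : ∀ {a b x} → E A a (πA x) → E B b (πB x) → E X (pair a b) x
  E-pair {a} {b} {x} ea eb = subst T (≡-sym (adj-π (pair a b) x)) (Equivalence.from T-∧
    ( subst (λ a′ → E A a′ (πA x)) (≡-sym (πA-pair a b)) ea
    , subst (λ b′ → E B b′ (πB x)) (≡-sym (πB-pair a b)) eb))

  pair-injectiveʳ : ∀ {a a′ b b′} → pair a b ≡ pair a′ b′ → b ≡ b′
  pair-injectiveʳ {a} {a′} {b} {b′} eq = trans (≡-sym (πB-pair a b)) (trans (cong πB eq) (πB-pair a′ b′))

  pair-∈-preimage : ∀ {S a} b → a ∈ S → pair a b ∈ preimage πA S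
  pair-∈-preimage {S} {a} b a∈S = ∈-preimage⁺ (subst (_∈ S) (≡-sym (πA-pair a b)) a∈S)

  preimage-independent : ∀ {I} → Independent A I → Independent X (preimage πA I)
  preimage-independent ind x y x∈ y∈ = ind (πA x) (πA y) (∈-preimage⁻ x∈) (∈-preimage⁻ y∈) ∘ E-πA

  preimage-dominating : (∀ h → ∃[ h′ ] E B h′ h) → ∀ {D} → Dominating A D → Dominating X (preimage πA D)
  preimage-dominating no-isolated dom x with dom (πA x) | no-isolated (πB x)
  ... | inj₁ πx∈D          | _        = inj₁ (∈-preimage⁺ πx∈D)
  ... | inj₂ (d , d∈D , e) | h′ , e′  = inj₂ (pair d h′ , pair-∈-preimage h′ d∈D , E-pair e e′)

  module _ {D : Subset (order A)} {u : Fin (order A)} {h₀ : Fin (order B)} where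

    Punctured : Subset (order X)
    Punctured = preimage πA D - pair u h₀

    pair-∈-punctured : ∀ {a b} → a ∈ D → b ≢ h₀ → pair a b ∈ Punctured
    pair-∈-punctured {b = b} a∈D b≢h₀ = x∈p∧x≢y⇒x∈p-y (pair-∈-preimage b a∈D) (b≢h₀ ∘ pair-injectiveʳ)

    punctured-dominating : Avoidable B h₀ → Dominating A D → ∀ {v} → v ∈ D → E A u v →
                           Dominating X Punctured
    punctured-dominating avoid dom {v} v∈D uv x with x ≟ pair u h₀
    ... | yes refl with avoid h₀
    ...   | h′ , h′≢h₀ , e′ = inj₂ (pair v h′ , pair-∈-punctured v∈D h′≢h₀ ,
            E-pair (subst (E A v) (≡-sym (πA-pair u h₀)) (E-sym A uv))
                   (subst (E B h′) (≡-sym (πB-pair u h₀)) e′))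
    punctured-dominating avoid dom v∈D uv x | no x≢uh₀ with dom (πA x) | avoid (πB x)
    ...   | inj₁ πx∈D          | _ = inj₁ (x∈p∧x≢y⇒x∈p-y (∈-preimage⁺ πx∈D) x≢uh₀)
    ...   | inj₂ (d , d∈D , e) | h′ , h′≢h₀ , e′ = inj₂ (pair d h′ , pair-∈-punctured d∈D h′≢h₀ , E-pair e e′)

    ∣punctured∣<∣D∣*∣B∣ : u ∈ D → ∣ Punctured ∣ < ∣ D ∣ * order B
    ∣punctured∣<∣D∣*∣B∣ u∈D = subst (∣ Punctured ∣ <_) (∣preimage-πA∣ D) (x∈p⇒∣p-x∣<∣p∣ (pair-∈-preimage h₀ u∈D))

  wellDominated⇒minimumDominating-independent :
    WellDominated X → ∃ (Avoidable B) → ∀ D → MinimumDominating A D → Independent A D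
  wellDominated⇒minimumDominating-independent wd (h₀ , avoid) D (domD , minD) u v u∈D v∈D uv =
    <-irrefl refl (begin-strict
      ∣ M ∣                 ≤⟨ wd M (domM , independent⇒minimal X indM) D* minimumD* ⟩
      ∣ D* ∣                ≤⟨ proj₂ minimumD* S domS ⟩
      ∣ S ∣                 <⟨ ∣punctured∣<∣D∣*∣B∣ u∈D ⟩
      ∣ D ∣ * order B       ≤⟨ *-monoˡ-≤ (order B) (minD I domI) ⟩
      ∣ I ∣ * order B       ≡⟨ ∣preimage-πA∣ I ⟨
      ∣ M ∣                 ∎)
    where
    open ≤-Reasoning
    I : Subset (order A)
    I = proj₁ (maximalIndependent-exists A)
    maximalI : MaximalIndependent A I
    maximalI = proj₂ (maximalIndependent-exists A)
    domI : Dominating A I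
    domI = maximalIndependent⇒dominating A maximalI
    M : Subset (order X)
    M = preimage πA I
    indM : Independent X M
    indM = preimage-independent (proj₁ maximalI)
    domM : Dominating X M
    domM = preimage-dominating (λ h → map₂ proj₂ (avoid h)) domI
    S : Subset (order X)
    S = Punctured {D} {u} {h₀}
    domS : Dominating X S
    domS = punctured-dominating avoid domD v∈D uv
    D* : Subset (order X)
    D* = proj₁ (minimumDominating-exists X domS)
    minimumD* : MinimumDominating X D*
    minimumD* = proj₂ (minimumDominating-exists X domS)

corollary2 : (G H : Graph) → Connected G → Connected H
    → 3 ≤ order G → 3 ≤ order H
    → WellDominated (G ×ᴳ H)
    → (∀ D → MinimumDominating G D → Independent G D)
      × (∀ D → MinimumDominating H D → Independent H D)
corollary2 G H connectedG connectedH 3≤G 3≤H wd =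
  wellDominated⇒minimumDominating-independent (×ᴳ-first G H) wd (avoidable-exists H connectedH 3≤H) ,
  wellDominated⇒minimumDominating-independent (×ᴳ-second G H) wd (avoidable-exists G connectedG 3≤G)
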